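{- Let $oc(n)$ denote the number of weakly unimodal compositions of $n$ into powers of $2$ in which each part size that occurs appears in a single block of consecutive positions and appears an odd number of times (with $oc(0)=1$, counting the empty composition). Then for all integers $n\geq 2$, $$oc(n)=\begin{cases} oc(n/2) & \text{if } n \text{ is even},\\ 2\,oc(n-1)+oc(n-2) & \text{if } n \text{ is odd}.\end{cases}$$
   Context: A composition of $n$ is a finite sequence of positive integers summing to $n$. A composition is weakly unimodal if it has the form $(a_1,\dots,a_r,c,b_s,\dots,b_1)$ with $a_1\le a_2\le\cdots\le a_r\le c> b_s\ge\cdots\ge b_1\ge 1$ (either the $a$'s or the $b$'s may be absent). For example, $(16,4^3,2^3,1^{11})$ is counted by $oc(45)$, while $(2^3,4^3,16,2,1^9)$ is not, since the part size $2$ occurs in two separate places. -}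

module Defs where

open import Data.Nat using (ℕ; zero; suc; _+_; _*_; _∸_; _^_; _≡ᵇ_; _≤ᵇ_)
open import Data.Bool using (Bool; true; false; _∧_; _∨_; not; if_then_else_)
open import Data.List using (List; []; _∷_; map; concatMap; length; filter; take; drop; upTo)
open import Data.Bool.ListAction using (any; all)
open import Data.Product using (_×_; _,_; proj₁; proj₂)
open import Relation.Nullary.Decidable using (Dec)
open import Relation.Binary.PropositionalEquality using (_≡_)
open import Data.Bool.Properties using (_≟_)

range1 : ℕ → List ℕ
range1 m = map suc (upTo m)

-- All compositions of m (sequences of positive integers summing to m),
-- using `fuel` to bound the number of parts (fuel = m suffices since parts ≥ 1).
compsF : ℕ → ℕ → List (List ℕ)
compsF fuel    zero    = [] ∷ []
compsF zero    (suc m) = []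
compsF (suc f) (suc m) =
  concatMap (λ k → map (k ∷_) (compsF f (suc m ∸ k))) (range1 (suc m))

compositions : ℕ → List (List ℕ)
compositions n = compsF n n

-- x is a power of 2 (2^k for some k; k ≤ x suffices)
isPow2 : ℕ → Bool
isPow2 x = any (λ k → (2 ^ k) ≡ᵇ x) (upTo (suc x))

nondecr : List ℕ → Bool
nondecr []           = true
nondecr (x ∷ [])     = true
nondecr (x ∷ y ∷ xs) = (x ≤ᵇ y) ∧ nondecr (y ∷ xs)

nonincr : List ℕ → Bool
nonincr []           = true
nonincr (x ∷ [])     = true
nonincr (x ∷ y ∷ xs) = (y ≤ᵇ x) ∧ nonincr (y ∷ xs)

weaklyUnimodal : List ℕ → Bool
weaklyUnimodal xs =
  any (λ i → nondecr (take i xs) ∧ nonincr (drop i xs)) (upTo (suc (length xs)))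

runs : List ℕ → List (ℕ × ℕ)
runs [] = []
runs (x ∷ xs) with runs xs
... | [] = (x , 1) ∷ []
... | (v , c) ∷ rs = if v ≡ᵇ x then (v , suc c) ∷ rs else (x , 1) ∷ (v , c) ∷ rs

isOdd : ℕ → Bool
isOdd zero    = false
isOdd (suc n) = not (isOdd n)

distinct : List ℕ → Bool
distinct []       = true
distinct (x ∷ xs) = all (λ y → not (x ≡ᵇ y)) xs ∧ distinct xs

-- each occurring part size appears in a single block of consecutive
-- positions (the run values are distinct) and an odd number of times
singleOddBlocks : List ℕ → Bool
singleOddBlocks xs =
  distinct (map proj₁ (runs xs)) ∧ all (λ r → isOdd (proj₂ r)) (runs xs)

isOC : List ℕ → Bool
isOC xs = all isPow2 xs ∧ weaklyUnimodal xs ∧ singleOddBlocks xs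

oc : ℕ → ℕ
oc n = length (filter (λ xs → isOC xs ≟ true) (compositions n))

module Submission where

-- In a weakly unimodal composition into powers of 2 the part 1 is minimal, so its single block of
-- equal parts sits at the left or the right end; that block has odd length and every other part is
-- even, hence a 1 occurs exactly when the sum is odd. For even n halving every part is therefore a
-- bijection onto the compositions of n/2. For odd n a composition either has a lone 1 at an end,
-- whose removal leaves a composition of n - 1 (with the 1 on the left or on the right), or a block of
-- at least three 1s at an end, which shortened by two 1s leaves a composition of n - 2; conversely
-- every composition of n - 2 has its 1-block at an end, where two more 1s can be added.

open import Defs
open import Data.Nat using (ℕ; zero; suc; _+_; _*_; _∸_; _/_; _%_; _^_; _≤_; _<_; z≤n; s≤s; _≡ᵇ_; _≤ᵇ_; ⌊_/2⌋)
open import Data.Nat.Properties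
  using (≡ᵇ⇒≡; ≡⇒≡ᵇ; ≤ᵇ⇒≤; ≤⇒≤ᵇ; *-cancelˡ-≡; *-cancelˡ-≤; *-monoʳ-≤; +-identityʳ; +-comm; +-assoc;
         ≤-trans; ≤-refl; ≤-reflexive; ≤-antisym; +-mono-≤; m+[n∸m]≡n; *-distribˡ-+; suc-injective;
         m+n∸m≡n; *-comm; m≤m+n; n≤1+n; n≡⌊n+n/2⌋)
open import Data.Nat.DivMod using (m≡m%n+[m/n]*n)
open import Data.Nat.ListAction using (sum)
open import Data.Nat.ListAction.Properties using (sum-++; sum-↭)
open import Data.Bool using (Bool; true; false; _∧_; _∨_; not; _xor_; if_then_else_)
open import Data.Bool.Properties
  using (_≟_; ∧-assoc; ∧-comm; ∧-identityʳ; ∧-idem; ∧-conicalˡ; ∧-conicalʳ; not-involutive;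
         xor-same; not-distribˡ-xor; xor-identityʳ; T-≡)
open import Data.Bool.ListAction using (any; all)
open import Data.Bool.Solver using (module ∨-∧-Solver)
open ∨-∧-Solver using (solve; _:*_; _:=_; con)
open import Data.Product using (_×_; ∃; ∃₂; _,_; proj₁; proj₂)
open import Data.Sum using (_⊎_; inj₁; inj₂)
open import Data.Empty using (⊥-elim)
open import Data.List
  using (List; []; _∷_; _++_; map; reverse; length; filter; take; drop; upTo; concatMap; replicate)
open import Data.List.Properties
  using (length-map; take-map; drop-map; take++drop≡id; unfold-reverse; reverse-++; reverse-involutive;
         reverse-map; length-++; length-++-≤ˡ; ++-assoc)
open import Data.List.Relation.Unary.All using (All; []; _∷_; lookup)
open import Data.List.Relation.Unary.AllPairs using ([]; _∷_)
open import Data.List.Relation.Unary.Any using (here; there)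
open import Data.List.Relation.Unary.Any.Properties using (reverse⁺)
open import Data.List.Membership.Propositional using (_∈_; find; lose)
open import Data.List.Membership.Propositional.Properties
  using (∈-map⁺; ∈-map⁻; ∈-++⁺ˡ; ∈-++⁺ʳ; ∈-++⁻; ∈-upTo⁺; ∈-upTo⁻; ∈-filter⁺; ∈-filter⁻;
         ∈-concatMap⁺; ∈-concatMap⁻)
open import Data.List.Membership.Propositional.Properties.WithK using (unique∧set⇒bag)
open import Data.List.Relation.Unary.Unique.Propositional using (Unique)
open import Data.List.Relation.Unary.Unique.Propositional.Properties using (map⁺; ++⁺; filter⁺; upTo⁺)
open import Data.List.Relation.Binary.Disjoint.Propositional using (Disjoint)
open import Data.List.Relation.Binary.BagAndSetEquality using (∼bag⇒↭)
open import Data.List.Relation.Binary.Permutation.Propositional.Properties using (↭-length; ↭-reverse)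
open import Function.Bundles using (mk⇔; Equivalence)
open import Relation.Binary.PropositionalEquality
  using (_≡_; _≢_; refl; sym; trans; cong; cong₂; subst; module ≡-Reasoning)

∧-intro : ∀ {a b} → a ≡ true → b ≡ true → a ∧ b ≡ true
∧-intro refl q = q

true⇔true⇒≡ : ∀ {a b} → (a ≡ true → b ≡ true) → (b ≡ true → a ≡ true) → a ≡ b
true⇔true⇒≡ {true}          f g = sym (f refl)
true⇔true⇒≡ {false} {false} f g = refl
true⇔true⇒≡ {false} {true}  f g = g refl

not≡true⇒≡false : ∀ {b} → not b ≡ true → b ≡ false
not≡true⇒≡false {false} _ = refl

not≡false⇒≡true : ∀ {b} → not b ≡ false → b ≡ true
not≡false⇒≡true {true} _ = refl

true≢false : true ≢ false
true≢false ()

subst-true : ∀ {A : Set} (p : A → Bool) {a b} → a ≡ b → p a ≡ true → p b ≡ true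
subst-true p refl e = e

≡ᵇ-true⇒≡ : ∀ {m n} → (m ≡ᵇ n) ≡ true → m ≡ n
≡ᵇ-true⇒≡ {m} {n} p = ≡ᵇ⇒≡ m n (Equivalence.from T-≡ p)

≡⇒≡ᵇ-true : ∀ {m n} → m ≡ n → (m ≡ᵇ n) ≡ true
≡⇒≡ᵇ-true {m} {n} p = Equivalence.to T-≡ (≡⇒≡ᵇ m n p)

≡ᵇ-refl : ∀ n → (n ≡ᵇ n) ≡ true
≡ᵇ-refl n = ≡⇒≡ᵇ-true {n} refl

≤ᵇ-true⇒≤ : ∀ {m n} → (m ≤ᵇ n) ≡ true → m ≤ n
≤ᵇ-true⇒≤ {m} {n} p = ≤ᵇ⇒≤ m n (Equivalence.from T-≡ p)

≤⇒≤ᵇ-true : ∀ {m n} → m ≤ n → (m ≤ᵇ n) ≡ true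
≤⇒≤ᵇ-true m≤n = Equivalence.to T-≡ (≤⇒≤ᵇ m≤n)

≡ᵇ-sym : ∀ m n → (m ≡ᵇ n) ≡ (n ≡ᵇ m)
≡ᵇ-sym m n = true⇔true⇒≡ (λ p → ≡⇒≡ᵇ-true (sym (≡ᵇ-true⇒≡ {m} p)))
                         (λ p → ≡⇒≡ᵇ-true (sym (≡ᵇ-true⇒≡ {n} p)))

≡ᵇ-double : ∀ m n → (2 * m ≡ᵇ 2 * n) ≡ (m ≡ᵇ n)
≡ᵇ-double m n = true⇔true⇒≡ (λ p → ≡⇒≡ᵇ-true (*-cancelˡ-≡ m n 2 (≡ᵇ-true⇒≡ {2 * m} p)))
                            (λ p → ≡⇒≡ᵇ-true (cong (2 *_) (≡ᵇ-true⇒≡ {m} p)))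

≤ᵇ-double : ∀ m n → (2 * m ≤ᵇ 2 * n) ≡ (m ≤ᵇ n)
≤ᵇ-double m n = true⇔true⇒≡ (λ p → ≤⇒≤ᵇ-true (*-cancelˡ-≤ {m} {n} 2 (≤ᵇ-true⇒≤ {2 * m} p)))
                            (λ p → ≤⇒≤ᵇ-true (*-monoʳ-≤ 2 (≤ᵇ-true⇒≤ {m} p)))

any⇒∃ : ∀ {A : Set} (p : A → Bool) xs → any p xs ≡ true → ∃ λ x → p x ≡ true
any⇒∃ p (x ∷ xs) e with p x in px
... | true  = x , px
... | false = any⇒∃ p xs e

∈⇒any : ∀ {A : Set} (p : A → Bool) {x} xs → x ∈ xs → p x ≡ true → any p xs ≡ true
∈⇒any p (y ∷ ys) (here refl) e rewrite e = refl
∈⇒any p (y ∷ ys) (there x∈ys) e with p y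
... | true  = refl
... | false = ∈⇒any p ys x∈ys e

all⇒∈ : ∀ {A : Set} (p : A → Bool) xs → all p xs ≡ true → ∀ {x} → x ∈ xs → p x ≡ true
all⇒∈ p (y ∷ ys) e (here refl)  = ∧-conicalˡ (p y) _ e
all⇒∈ p (y ∷ ys) e (there x∈ys) = all⇒∈ p ys (∧-conicalʳ (p y) _ e) x∈ys

all≡false⇒∃ : ∀ {A : Set} (p : A → Bool) xs → all p xs ≡ false → ∃ λ x → x ∈ xs × p x ≡ false
all≡false⇒∃ p (x ∷ xs) e with p x in px
... | false = x , here refl , px
... | true with all≡false⇒∃ p xs e
...   | y , y∈xs , py = y , there y∈xs , py

all-++ : ∀ {A : Set} (p : A → Bool) xs ys → all p (xs ++ ys) ≡ all p xs ∧ all p ys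
all-++ p []       ys = refl
all-++ p (x ∷ xs) ys rewrite all-++ p xs ys = sym (∧-assoc (p x) (all p xs) (all p ys))

all-reverse : ∀ {A : Set} (p : A → Bool) xs → all p (reverse xs) ≡ all p xs
all-reverse p []       = refl
all-reverse p (x ∷ xs)
  rewrite unfold-reverse x xs | all-++ p (reverse xs) (x ∷ []) | all-reverse p xs | ∧-identityʳ (p x)
  = ∧-comm (all p xs) (p x)

all-map : ∀ {A B : Set} (p : B → Bool) (f : A → B) xs → all p (map f xs) ≡ all (λ x → p (f x)) xs
all-map p f []       = refl
all-map p f (x ∷ xs) = cong (p (f x) ∧_) (all-map p f xs)

all-cong : ∀ {A : Set} {p q : A → Bool} → (∀ x → p x ≡ q x) → ∀ xs → all p xs ≡ all q xs
all-cong e []       = refl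
all-cong e (x ∷ xs) = cong₂ _∧_ (e x) (all-cong e xs)

any-cong : ∀ {A : Set} {p q : A → Bool} → (∀ x → p x ≡ q x) → ∀ xs → any p xs ≡ any q xs
any-cong e []       = refl
any-cong e (x ∷ xs) = cong₂ _∨_ (e x) (any-cong e xs)

isOdd-+ : ∀ a b → isOdd (a + b) ≡ isOdd a xor isOdd b
isOdd-+ zero    b = refl
isOdd-+ (suc a) b rewrite isOdd-+ a b = not-distribˡ-xor (isOdd a) (isOdd b)

isOdd-double : ∀ h → isOdd (2 * h) ≡ false
isOdd-double h rewrite isOdd-+ h (h + 0) | +-identityʳ h = xor-same (isOdd h)

n<2^n : ∀ n → n < 2 ^ n
n<2^n zero    = s≤s z≤n
n<2^n (suc n) = ≤-trans (s≤s (n<2^n n))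
  (+-mono-≤ (≤-trans (s≤s z≤n) (n<2^n n)) (≤-reflexive (sym (+-identityʳ (2 ^ n)))))

isPow2⇒∃ : ∀ {x} → isPow2 x ≡ true → ∃ λ k → 2 ^ k ≡ x
isPow2⇒∃ {x} e with any⇒∃ (λ k → (2 ^ k) ≡ᵇ x) (upTo (suc x)) e
... | k , q = k , ≡ᵇ-true⇒≡ q

isPow2-^ : ∀ k → isPow2 (2 ^ k) ≡ true
isPow2-^ k = ∈⇒any (λ j → (2 ^ j) ≡ᵇ (2 ^ k)) (upTo (suc (2 ^ k)))
               (∈-upTo⁺ (≤-trans (n<2^n k) (n≤1+n (2 ^ k)))) (≡ᵇ-refl (2 ^ k))

isPow2⇒1≤ : ∀ {x} → isPow2 x ≡ true → 1 ≤ x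
isPow2⇒1≤ {x} e with isPow2⇒∃ {x} e
... | k , refl = ≤-trans (s≤s z≤n) (n<2^n k)

isPow2-double : ∀ x → isPow2 (2 * x) ≡ isPow2 x
isPow2-double x = true⇔true⇒≡ halve (λ e → double (isPow2⇒∃ {x} e))
  where
  halve : isPow2 (2 * x) ≡ true → isPow2 x ≡ true
  halve e with isPow2⇒∃ {2 * x} e
  ... | zero  , 1≡2x = ⊥-elim (true≢false (trans (cong isOdd 1≡2x) (isOdd-double x)))
  ... | suc j , q rewrite sym (*-cancelˡ-≡ (2 ^ j) x 2 q) = isPow2-^ j
  double : (∃ λ k → 2 ^ k ≡ x) → isPow2 (2 * x) ≡ true
  double (k , refl) = isPow2-^ (suc k)

isPow2⇒even : ∀ {x} → isPow2 x ≡ true → (1 ≡ᵇ x) ≡ false → ∃ λ h → x ≡ 2 * h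
isPow2⇒even {x} e x≢1 with isPow2⇒∃ {x} e
... | zero  , refl = ⊥-elim (true≢false x≢1)
... | suc j , refl = 2 ^ j , refl

chain : (ℕ → ℕ → Bool) → List ℕ → Bool
chain R []           = true
chain R (x ∷ [])     = true
chain R (x ∷ y ∷ xs) = R x y ∧ chain R (y ∷ xs)

nondecr≡chain : ∀ xs → nondecr xs ≡ chain _≤ᵇ_ xs
nondecr≡chain []           = refl
nondecr≡chain (x ∷ [])     = refl
nondecr≡chain (x ∷ y ∷ xs) = cong ((x ≤ᵇ y) ∧_) (nondecr≡chain (y ∷ xs))

nonincr≡chain : ∀ xs → nonincr xs ≡ chain (λ a b → b ≤ᵇ a) xs
nonincr≡chain []           = refl
nonincr≡chain (x ∷ [])     = refl
nonincr≡chain (x ∷ y ∷ xs) = cong ((y ≤ᵇ x) ∧_) (nonincr≡chain (y ∷ xs))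

chain-++ : ∀ R xs y ys → chain R (xs ++ y ∷ ys) ≡ chain R (xs ++ y ∷ []) ∧ chain R (y ∷ ys)
chain-++ R []           y ys = refl
chain-++ R (x ∷ [])     y ys rewrite ∧-identityʳ (R x y) = refl
chain-++ R (x ∷ z ∷ xs) y ys rewrite chain-++ R (z ∷ xs) y ys =
  sym (∧-assoc (R x z) (chain R (z ∷ xs ++ y ∷ [])) (chain R (y ∷ ys)))

reverse-∷-∷ : ∀ {A : Set} (x y : A) ys → reverse (x ∷ y ∷ ys) ≡ reverse ys ++ y ∷ x ∷ []
reverse-∷-∷ x y ys = begin
  reverse (x ∷ y ∷ ys)            ≡⟨ unfold-reverse x (y ∷ ys) ⟩
  reverse (y ∷ ys) ++ x ∷ []      ≡⟨ cong (_++ x ∷ []) (unfold-reverse y ys) ⟩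
  (reverse ys ++ y ∷ []) ++ x ∷ [] ≡⟨ ++-assoc (reverse ys) (y ∷ []) (x ∷ []) ⟩
  reverse ys ++ y ∷ x ∷ []        ∎
  where open ≡-Reasoning

chain-reverse : ∀ R xs → chain R (reverse xs) ≡ chain (λ a b → R b a) xs
chain-reverse R []           = refl
chain-reverse R (x ∷ [])     = refl
chain-reverse R (x ∷ y ∷ ys) = begin
  chain R (reverse (x ∷ y ∷ ys))                   ≡⟨ cong (chain R) (reverse-∷-∷ x y ys) ⟩
  chain R (reverse ys ++ y ∷ x ∷ [])               ≡⟨ chain-++ R (reverse ys) y (x ∷ []) ⟩
  chain R (reverse ys ++ y ∷ []) ∧ (R y x ∧ true)  ≡⟨ cong₂ _∧_ (cong (chain R) (sym (unfold-reverse y ys)))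
                                                                 (∧-identityʳ (R y x)) ⟩
  chain R (reverse (y ∷ ys)) ∧ R y x               ≡⟨ cong (_∧ R y x) (chain-reverse R (y ∷ ys)) ⟩
  chain R⁻¹ (y ∷ ys) ∧ R y x                       ≡⟨ ∧-comm (chain R⁻¹ (y ∷ ys)) (R y x) ⟩
  R y x ∧ chain R⁻¹ (y ∷ ys)                       ∎
  where
  open ≡-Reasoning
  R⁻¹ : ℕ → ℕ → Bool
  R⁻¹ a b = R b a

chain-map : ∀ R (f : ℕ → ℕ) xs → chain R (map f xs) ≡ chain (λ a b → R (f a) (f b)) xs
chain-map R f []           = refl
chain-map R f (x ∷ [])     = refl
chain-map R f (x ∷ y ∷ xs) = cong (R (f x) (f y) ∧_) (chain-map R f (y ∷ xs))

chain-cong : ∀ {R S} → (∀ a b → R a b ≡ S a b) → ∀ xs → chain R xs ≡ chain S xs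
chain-cong e []           = refl
chain-cong e (x ∷ [])     = refl
chain-cong e (x ∷ y ∷ xs) = cong₂ _∧_ (e x y) (chain-cong e (y ∷ xs))

nondecr-reverse : ∀ xs → nondecr (reverse xs) ≡ nonincr xs
nondecr-reverse xs = begin
  nondecr (reverse xs)                ≡⟨ nondecr≡chain (reverse xs) ⟩
  chain _≤ᵇ_ (reverse xs)             ≡⟨ chain-reverse _≤ᵇ_ xs ⟩
  chain (λ a b → b ≤ᵇ a) xs           ≡⟨ sym (nonincr≡chain xs) ⟩
  nonincr xs                          ∎
  where open ≡-Reasoning

nonincr-reverse : ∀ xs → nonincr (reverse xs) ≡ nondecr xs
nonincr-reverse xs = begin
  nonincr (reverse xs)                ≡⟨ nonincr≡chain (reverse xs) ⟩
  chain (λ a b → b ≤ᵇ a) (reverse xs) ≡⟨ chain-reverse (λ a b → b ≤ᵇ a) xs ⟩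
  chain _≤ᵇ_ xs                       ≡⟨ sym (nondecr≡chain xs) ⟩
  nondecr xs                          ∎
  where open ≡-Reasoning

nondecr-double : ∀ xs → nondecr (map (2 *_) xs) ≡ nondecr xs
nondecr-double xs = begin
  nondecr (map (2 *_) xs)                 ≡⟨ nondecr≡chain (map (2 *_) xs) ⟩
  chain _≤ᵇ_ (map (2 *_) xs)              ≡⟨ chain-map _≤ᵇ_ (2 *_) xs ⟩
  chain (λ a b → 2 * a ≤ᵇ 2 * b) xs       ≡⟨ chain-cong ≤ᵇ-double xs ⟩
  chain _≤ᵇ_ xs                           ≡⟨ sym (nondecr≡chain xs) ⟩
  nondecr xs                              ∎
  where open ≡-Reasoning

nonincr-double : ∀ xs → nonincr (map (2 *_) xs) ≡ nonincr xs
nonincr-double xs = begin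
  nonincr (map (2 *_) xs)                 ≡⟨ nonincr≡chain (map (2 *_) xs) ⟩
  chain (λ a b → b ≤ᵇ a) (map (2 *_) xs)  ≡⟨ chain-map (λ a b → b ≤ᵇ a) (2 *_) xs ⟩
  chain (λ a b → 2 * b ≤ᵇ 2 * a) xs       ≡⟨ chain-cong (λ a b → ≤ᵇ-double b a) xs ⟩
  chain (λ a b → b ≤ᵇ a) xs               ≡⟨ sym (nonincr≡chain xs) ⟩
  nonincr xs                              ∎
  where open ≡-Reasoning

nondecr-tail : ∀ {x} xs → nondecr (x ∷ xs) ≡ true → nondecr xs ≡ true
nondecr-tail []       e = refl
nondecr-tail (y ∷ xs) e = ∧-conicalʳ _ _ e

nonincr-tail : ∀ {x} xs → nonincr (x ∷ xs) ≡ true → nonincr xs ≡ true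
nonincr-tail []       e = refl
nonincr-tail (y ∷ xs) e = ∧-conicalʳ _ _ e

nondecr-head-≤ : ∀ x xs {y} → nondecr (x ∷ xs) ≡ true → y ∈ x ∷ xs → x ≤ y
nondecr-head-≤ x xs       e (here refl)    = ≤-refl
nondecr-head-≤ x (z ∷ xs) e (there y∈z∷xs) =
  ≤-trans (≤ᵇ-true⇒≤ (∧-conicalˡ _ _ e)) (nondecr-head-≤ z xs (∧-conicalʳ _ _ e) y∈z∷xs)

take-length-++ : ∀ {A : Set} (xs ys : List A) → take (length xs) (xs ++ ys) ≡ xs
take-length-++ []       ys = refl
take-length-++ (x ∷ xs) ys = cong (x ∷_) (take-length-++ xs ys)

drop-length-++ : ∀ {A : Set} (xs ys : List A) → drop (length xs) (xs ++ ys) ≡ ys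
drop-length-++ []       ys = refl
drop-length-++ (x ∷ xs) ys = drop-length-++ xs ys

weaklyUnimodal⇒split : ∀ xs → weaklyUnimodal xs ≡ true →
  ∃₂ λ as bs → xs ≡ as ++ bs × nondecr as ≡ true × nonincr bs ≡ true
weaklyUnimodal⇒split xs e
  with any⇒∃ (λ i → nondecr (take i xs) ∧ nonincr (drop i xs)) (upTo (suc (length xs))) e
... | i , q = take i xs , drop i xs , sym (take++drop≡id i xs) , ∧-conicalˡ _ _ q , ∧-conicalʳ _ _ q

split⇒weaklyUnimodal : ∀ as bs → nondecr as ≡ true → nonincr bs ≡ true → weaklyUnimodal (as ++ bs) ≡ true
split⇒weaklyUnimodal as bs up down =
  ∈⇒any (λ i → nondecr (take i (as ++ bs)) ∧ nonincr (drop i (as ++ bs)))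
        (upTo (suc (length (as ++ bs)))) (∈-upTo⁺ (s≤s (length-++-≤ˡ as)))
        (subst (_≡ true) (sym (cong₂ _∧_ (cong nondecr (take-length-++ as bs)) (cong nonincr (drop-length-++ as bs))))
               (∧-intro up down))

weaklyUnimodal-tail : ∀ x xs → weaklyUnimodal (x ∷ xs) ≡ true → weaklyUnimodal xs ≡ true
weaklyUnimodal-tail x xs e with weaklyUnimodal⇒split (x ∷ xs) e
... | []     , bs , refl , up , down = split⇒weaklyUnimodal [] xs refl (nonincr-tail xs down)
... | _ ∷ as , bs , refl , up , down = split⇒weaklyUnimodal as bs (nondecr-tail as up) down

weaklyUnimodal-∷-min : ∀ x xs → (∀ {y} → y ∈ xs → x ≤ y) → weaklyUnimodal (x ∷ xs) ≡ weaklyUnimodal xs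
weaklyUnimodal-∷-min x xs x≤ = true⇔true⇒≡ (weaklyUnimodal-tail x xs) cons
  where
  cons : weaklyUnimodal xs ≡ true → weaklyUnimodal (x ∷ xs) ≡ true
  cons e with weaklyUnimodal⇒split xs e
  ... | []     , bs , refl , up , down = split⇒weaklyUnimodal (x ∷ []) bs refl down
  ... | y ∷ as , bs , refl , up , down =
    split⇒weaklyUnimodal (x ∷ y ∷ as) bs (∧-intro (≤⇒≤ᵇ-true (x≤ (here refl))) up) down

weaklyUnimodal-dup : ∀ x xs → weaklyUnimodal (x ∷ x ∷ xs) ≡ weaklyUnimodal (x ∷ xs)
weaklyUnimodal-dup x xs = true⇔true⇒≡ (weaklyUnimodal-tail x (x ∷ xs)) dup
  where
  dup : weaklyUnimodal (x ∷ xs) ≡ true → weaklyUnimodal (x ∷ x ∷ xs) ≡ true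
  dup e with weaklyUnimodal⇒split (x ∷ xs) e
  ... | []      , _  , refl , _  , down = split⇒weaklyUnimodal [] (x ∷ x ∷ xs) refl
                                            (∧-intro (≤⇒≤ᵇ-true (≤-refl {x})) down)
  ... | _ ∷ as , bs , refl , up , down = split⇒weaklyUnimodal (x ∷ x ∷ as) bs
                                            (∧-intro (≤⇒≤ᵇ-true (≤-refl {x})) up) down

weaklyUnimodal-reverse : ∀ xs → weaklyUnimodal xs ≡ true → weaklyUnimodal (reverse xs) ≡ true
weaklyUnimodal-reverse xs e with weaklyUnimodal⇒split xs e
... | as , bs , refl , up , down rewrite reverse-++ as bs =
  split⇒weaklyUnimodal (reverse bs) (reverse as) (trans (nondecr-reverse bs) down) (trans (nonincr-reverse as) up)

weaklyUnimodal-double : ∀ xs → weaklyUnimodal (map (2 *_) xs) ≡ weaklyUnimodal xs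
weaklyUnimodal-double xs rewrite length-map (2 *_) xs =
  any-cong (λ i → cong₂ _∧_ (trans (cong nondecr (take-map i xs)) (nondecr-double (take i xs)))
                            (trans (cong nonincr (drop-map i xs)) (nonincr-double (drop i xs))))
           (upTo (suc (length xs)))

consRun : ℕ → List (ℕ × ℕ) → List (ℕ × ℕ)
consRun x []             = (x , 1) ∷ []
consRun x ((v , c) ∷ rs) = if v ≡ᵇ x then (v , suc c) ∷ rs else (x , 1) ∷ (v , c) ∷ rs

runs-∷ : ∀ x xs → runs (x ∷ xs) ≡ consRun x (runs xs)
runs-∷ x xs with runs xs
... | []          = refl
... | (v , c) ∷ _ = refl

startsWith : ℕ → List ℕ → Bool
startsWith x []      = false
startsWith x (y ∷ _) = y ≡ᵇ x

startsWith⇒∷ : ∀ {x} ys → startsWith x ys ≡ true → ∃ λ t → ys ≡ x ∷ t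
startsWith⇒∷ (y ∷ t) h rewrite ≡ᵇ-true⇒≡ {y} h = t , refl

runs-∷-head : ∀ y t → ∃₂ λ c rs → runs (y ∷ t) ≡ (y , c) ∷ rs
runs-∷-head y t rewrite runs-∷ y t with runs t
... | [] = 1 , [] , refl
... | (v , c) ∷ rs with v ≡ᵇ y in v≡y
...   | true  = suc c , rs , cong (λ z → (z , suc c) ∷ rs) (≡ᵇ-true⇒≡ v≡y)
...   | false = 1 , (v , c) ∷ rs , refl

runs-∷-fresh : ∀ x ys → startsWith x ys ≡ false → runs (x ∷ ys) ≡ (x , 1) ∷ runs ys
runs-∷-fresh x []      e = refl
runs-∷-fresh x (y ∷ t) e with runs-∷-head y t
... | c , rs , eq rewrite runs-∷ x (y ∷ t) | eq | e = refl

runs-∷-repeat : ∀ x t c rs → runs (x ∷ t) ≡ (x , c) ∷ rs → runs (x ∷ x ∷ t) ≡ (x , suc c) ∷ rs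
runs-∷-repeat x t c rs eq rewrite runs-∷ x (x ∷ t) | eq | ≡ᵇ-refl x = refl

all-values-consRun : ∀ (p : ℕ → Bool) x R →
  all p (map proj₁ (consRun x R)) ≡ p x ∧ all p (map proj₁ R)
all-values-consRun p x []             = refl
all-values-consRun p x ((v , c) ∷ rs) with v ≡ᵇ x in v≡x
... | false = refl
... | true rewrite ≡ᵇ-true⇒≡ {v} v≡x =
  trans (cong (_∧ all p (map proj₁ rs)) (sym (∧-idem (p x)))) (∧-assoc (p x) (p x) _)

all-values-runs : ∀ (p : ℕ → Bool) xs → all p (map proj₁ (runs xs)) ≡ all p xs
all-values-runs p []       = refl
all-values-runs p (x ∷ xs) rewrite runs-∷ x xs =
  trans (all-values-consRun p x (runs xs)) (cong (p x ∧_) (all-values-runs p xs))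

leading-block : ∀ x xs → ∃₂ λ k w →
  x ∷ xs ≡ replicate (suc k) x ++ w × startsWith x w ≡ false × runs (x ∷ xs) ≡ (x , suc k) ∷ runs w
leading-block x []       = 0 , [] , refl , refl , refl
leading-block x (y ∷ ys) with y ≡ᵇ x in y≡x
... | false = 0 , y ∷ ys , refl , y≡x , runs-∷-fresh x (y ∷ ys) y≡x
... | true rewrite ≡ᵇ-true⇒≡ {y} y≡x with leading-block x ys
...   | k , w , split , fresh , rw = suc k , w , cong (x ∷_) split , fresh , runs-∷-repeat x ys (suc k) (runs w) rw

snocRun : List (ℕ × ℕ) → ℕ → List (ℕ × ℕ)
snocRun []             y = (y , 1) ∷ []
snocRun ((v , c) ∷ []) y = if v ≡ᵇ y then (v , suc c) ∷ [] else (v , c) ∷ (y , 1) ∷ []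
snocRun (r ∷ s ∷ R)    y = r ∷ snocRun (s ∷ R) y

consRun-snocRun : ∀ x R y → consRun x (snocRun R y) ≡ snocRun (consRun x R) y
consRun-snocRun x [] y with y ≡ᵇ x in y≡x
... | true rewrite ≡ᵇ-true⇒≡ {y} y≡x | ≡ᵇ-refl x = refl
... | false rewrite ≡ᵇ-sym x y | y≡x = refl
consRun-snocRun x ((v , c) ∷ []) y with v ≡ᵇ y in v≡y | v ≡ᵇ x in v≡x
... | true  | true  rewrite v≡y | v≡x = refl
... | true  | false rewrite v≡y | v≡x = refl
... | false | true  rewrite v≡y | v≡x = refl
... | false | false rewrite v≡y | v≡x = refl
consRun-snocRun x ((v , c) ∷ s ∷ R) y with v ≡ᵇ x
... | true  = refl
... | false = refl

runs-∷ʳ : ∀ xs y → runs (xs ++ y ∷ []) ≡ snocRun (runs xs) y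
runs-∷ʳ []       y = refl
runs-∷ʳ (x ∷ xs) y = begin
  runs (x ∷ (xs ++ y ∷ []))          ≡⟨ runs-∷ x (xs ++ y ∷ []) ⟩
  consRun x (runs (xs ++ y ∷ []))    ≡⟨ cong (consRun x) (runs-∷ʳ xs y) ⟩
  consRun x (snocRun (runs xs) y)    ≡⟨ consRun-snocRun x (runs xs) y ⟩
  snocRun (consRun x (runs xs)) y    ≡⟨ cong (λ R → snocRun R y) (sym (runs-∷ x xs)) ⟩
  snocRun (runs (x ∷ xs)) y          ∎
  where open ≡-Reasoning

snocRun-∷ʳ : ∀ R r y → snocRun (R ++ r ∷ []) y ≡ R ++ snocRun (r ∷ []) y
snocRun-∷ʳ []          r y = refl
snocRun-∷ʳ (s ∷ [])    r y = refl
snocRun-∷ʳ (s ∷ t ∷ R) r y = cong (s ∷_) (snocRun-∷ʳ (t ∷ R) r y)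

snocRun-reverse : ∀ R x → snocRun (reverse R) x ≡ reverse (consRun x R)
snocRun-reverse []             x = refl
snocRun-reverse ((v , c) ∷ rs) x
  rewrite unfold-reverse (v , c) rs | snocRun-∷ʳ (reverse rs) (v , c) x with v ≡ᵇ x
... | true  = sym (unfold-reverse (v , suc c) rs)
... | false = sym (reverse-∷-∷ (x , 1) (v , c) rs)

runs-reverse : ∀ xs → runs (reverse xs) ≡ reverse (runs xs)
runs-reverse []       = refl
runs-reverse (x ∷ xs) = begin
  runs (reverse (x ∷ xs))            ≡⟨ cong runs (unfold-reverse x xs) ⟩
  runs (reverse xs ++ x ∷ [])        ≡⟨ runs-∷ʳ (reverse xs) x ⟩
  snocRun (runs (reverse xs)) x      ≡⟨ cong (λ R → snocRun R x) (runs-reverse xs) ⟩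
  snocRun (reverse (runs xs)) x      ≡⟨ snocRun-reverse (runs xs) x ⟩
  reverse (consRun x (runs xs))      ≡⟨ cong reverse (sym (runs-∷ x xs)) ⟩
  reverse (runs (x ∷ xs))            ∎
  where open ≡-Reasoning

doubleRun : ℕ × ℕ → ℕ × ℕ
doubleRun (v , c) = 2 * v , c

consRun-double : ∀ x R → consRun (2 * x) (map doubleRun R) ≡ map doubleRun (consRun x R)
consRun-double x []             = refl
consRun-double x ((v , c) ∷ rs) rewrite ≡ᵇ-double v x with v ≡ᵇ x
... | true  = refl
... | false = refl

runs-double : ∀ xs → runs (map (2 *_) xs) ≡ map doubleRun (runs xs)
runs-double []       = refl
runs-double (x ∷ xs)
  rewrite runs-∷ (2 * x) (map (2 *_) xs) | runs-double xs | runs-∷ x xs = consRun-double x (runs xs)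

∧-shuffle : ∀ a b c d → (a ∧ (b ∧ true)) ∧ (c ∧ d) ≡ (b ∧ c) ∧ (a ∧ d)
∧-shuffle = solve 4 (λ a b c d → (a :* (b :* con true)) :* (c :* d) := (b :* c) :* (a :* d)) refl

distinct-∷ʳ : ∀ xs y → distinct (xs ++ y ∷ []) ≡ all (λ x → not (y ≡ᵇ x)) xs ∧ distinct xs
distinct-∷ʳ []       y = refl
distinct-∷ʳ (x ∷ xs) y
  rewrite all-++ (λ z → not (x ≡ᵇ z)) xs (y ∷ []) | distinct-∷ʳ xs y | ≡ᵇ-sym y x =
  ∧-shuffle (all (λ z → not (x ≡ᵇ z)) xs) (not (x ≡ᵇ y)) (all (λ z → not (y ≡ᵇ z)) xs) (distinct xs)

distinct-reverse : ∀ xs → distinct (reverse xs) ≡ distinct xs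
distinct-reverse []       = refl
distinct-reverse (x ∷ xs)
  rewrite unfold-reverse x xs | distinct-∷ʳ (reverse xs) x
        | all-reverse (λ z → not (x ≡ᵇ z)) xs | distinct-reverse xs = refl

distinct-double : ∀ xs → distinct (map (2 *_) xs) ≡ distinct xs
distinct-double []       = refl
distinct-double (x ∷ xs) =
  cong₂ _∧_ (trans (all-map (λ y → not (2 * x ≡ᵇ y)) (2 *_) xs) (all-cong (λ y → cong not (≡ᵇ-double x y)) xs))
            (distinct-double xs)

oddRun : ℕ × ℕ → Bool
oddRun r = isOdd (proj₂ r)

isOC⇒all-isPow2 : ∀ xs → isOC xs ≡ true → all isPow2 xs ≡ true
isOC⇒all-isPow2 xs e = ∧-conicalˡ _ _ e

isOC⇒weaklyUnimodal : ∀ xs → isOC xs ≡ true → weaklyUnimodal xs ≡ true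
isOC⇒weaklyUnimodal xs e = ∧-conicalˡ _ _ (∧-conicalʳ (all isPow2 xs) _ e)

isOC⇒distinct : ∀ xs → isOC xs ≡ true → distinct (map proj₁ (runs xs)) ≡ true
isOC⇒distinct xs e = ∧-conicalˡ _ _ (∧-conicalʳ (weaklyUnimodal xs) _ (∧-conicalʳ (all isPow2 xs) _ e))

isOC⇒oddRuns : ∀ xs → isOC xs ≡ true → all oddRun (runs xs) ≡ true
isOC⇒oddRuns xs e =
  ∧-conicalʳ (distinct (map proj₁ (runs xs))) _ (∧-conicalʳ (weaklyUnimodal xs) _ (∧-conicalʳ (all isPow2 xs) _ e))

isOC-intro : ∀ xs → all isPow2 xs ≡ true → weaklyUnimodal xs ≡ true →
  distinct (map proj₁ (runs xs)) ≡ true → all oddRun (runs xs) ≡ true → isOC xs ≡ true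
isOC-intro xs p w d o = ∧-intro p (∧-intro w (∧-intro d o))

isOC⇒1≤ : ∀ xs → isOC xs ≡ true → ∀ {y} → y ∈ xs → 1 ≤ y
isOC⇒1≤ xs e y∈xs = isPow2⇒1≤ (all⇒∈ isPow2 xs (isOC⇒all-isPow2 xs e) y∈xs)

isOC-reverse⁺ : ∀ xs → isOC xs ≡ true → isOC (reverse xs) ≡ true
isOC-reverse⁺ xs e = isOC-intro (reverse xs)
  (trans (all-reverse isPow2 xs) (isOC⇒all-isPow2 xs e))
  (weaklyUnimodal-reverse xs (isOC⇒weaklyUnimodal xs e))
  (subst-true (λ R → distinct (map proj₁ R)) (sym (runs-reverse xs))
    (subst-true distinct (sym (reverse-map proj₁ (runs xs)))
      (trans (distinct-reverse (map proj₁ (runs xs))) (isOC⇒distinct xs e))))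
  (subst-true (all oddRun) (sym (runs-reverse xs)) (trans (all-reverse oddRun (runs xs)) (isOC⇒oddRuns xs e)))

isOC-reverse : ∀ xs → isOC (reverse xs) ≡ isOC xs
isOC-reverse xs = true⇔true⇒≡
  (λ e → subst-true isOC (reverse-involutive xs) (isOC-reverse⁺ (reverse xs) e))
  (isOC-reverse⁺ xs)

isOC-double : ∀ xs → isOC (map (2 *_) xs) ≡ isOC xs
isOC-double xs = cong₂ _∧_ (trans (all-map isPow2 (2 *_) xs) (all-cong isPow2-double xs))
  (cong₂ _∧_ (weaklyUnimodal-double xs)
    (cong₂ _∧_ (trans (cong (λ R → distinct (map proj₁ R)) (runs-double xs))
                  (trans (cong distinct (values-double (runs xs))) (distinct-double (map proj₁ (runs xs)))))
               (trans (cong (all oddRun) (runs-double xs)) (all-map oddRun doubleRun (runs xs)))))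
  where
  values-double : ∀ R → map proj₁ (map doubleRun R) ≡ map (2 *_) (map proj₁ R)
  values-double []      = refl
  values-double (r ∷ R) = cong (2 * proj₁ r ∷_) (values-double R)

noOnes : List ℕ → Bool
noOnes = all (λ y → not (1 ≡ᵇ y))

noOnes⇒¬startsWith-1 : ∀ ys → noOnes ys ≡ true → startsWith 1 ys ≡ false
noOnes⇒¬startsWith-1 []       e = refl
noOnes⇒¬startsWith-1 (y ∷ ys) e = trans (≡ᵇ-sym y 1) (not≡true⇒≡false (∧-conicalˡ _ _ e))

isOC-prepend-1 : ∀ ys → isOC ys ≡ true → noOnes ys ≡ true → isOC (1 ∷ ys) ≡ true
isOC-prepend-1 ys e no1 = isOC-intro (1 ∷ ys) (isOC⇒all-isPow2 ys e)
  (trans (weaklyUnimodal-∷-min 1 ys (isOC⇒1≤ ys e)) (isOC⇒weaklyUnimodal ys e))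
  (subst-true (λ R → distinct (map proj₁ R)) (sym runs-1∷ys)
    (∧-intro (trans (all-values-runs _ ys) no1) (isOC⇒distinct ys e)))
  (subst-true (all oddRun) (sym runs-1∷ys) (isOC⇒oddRuns ys e))
  where
  runs-1∷ys : runs (1 ∷ ys) ≡ (1 , 1) ∷ runs ys
  runs-1∷ys = runs-∷-fresh 1 ys (noOnes⇒¬startsWith-1 ys no1)

isOC-drop-1 : ∀ t → isOC (1 ∷ t) ≡ true → startsWith 1 t ≡ false → isOC t ≡ true
isOC-drop-1 t e fresh = isOC-intro t (isOC⇒all-isPow2 (1 ∷ t) e)
  (weaklyUnimodal-tail 1 t (isOC⇒weaklyUnimodal (1 ∷ t) e))
  (∧-conicalʳ _ _ (subst-true (λ R → distinct (map proj₁ R)) runs-1∷t (isOC⇒distinct (1 ∷ t) e)))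
  (subst-true (all oddRun) runs-1∷t (isOC⇒oddRuns (1 ∷ t) e))
  where
  runs-1∷t : runs (1 ∷ t) ≡ (1 , 1) ∷ runs t
  runs-1∷t = runs-∷-fresh 1 t fresh

isOC-1∷1∷ : ∀ t → isOC (1 ∷ 1 ∷ 1 ∷ t) ≡ isOC (1 ∷ t)
isOC-1∷1∷ t with runs-∷-head 1 t
... | c , rs , runs-1∷t =
  cong (all isPow2 t ∧_)
       (cong₂ _∧_ (trans (weaklyUnimodal-dup 1 (1 ∷ t)) (weaklyUnimodal-dup 1 t)) singleOddBlocks-1∷1∷)
  where
  runs-1∷1∷1∷t : runs (1 ∷ 1 ∷ 1 ∷ t) ≡ (1 , suc (suc c)) ∷ rs
  runs-1∷1∷1∷t = runs-∷-repeat 1 (1 ∷ t) (suc c) rs (runs-∷-repeat 1 t c rs runs-1∷t)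
  singleOddBlocks-1∷1∷ : singleOddBlocks (1 ∷ 1 ∷ 1 ∷ t) ≡ singleOddBlocks (1 ∷ t)
  singleOddBlocks-1∷1∷ rewrite runs-1∷1∷1∷t | runs-1∷t | not-involutive (isOdd c) = refl

isOC-drop-11 : ∀ t → isOC (1 ∷ 1 ∷ t) ≡ true → ∃ λ u → t ≡ 1 ∷ u × isOC t ≡ true
isOC-drop-11 t e with startsWith 1 t in starts
-- a leading block of exactly two 1s has even length
... | false = ⊥-elim (true≢false (sym (∧-conicalˡ (isOdd 2) (all oddRun (runs t))
  (subst-true (all oddRun) (runs-∷-repeat 1 t 1 (runs t) (runs-∷-fresh 1 t starts)) (isOC⇒oddRuns (1 ∷ 1 ∷ t) e)))))
... | true with startsWith⇒∷ t starts
...   | u , refl = u , refl , trans (sym (isOC-1∷1∷ u)) e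

sum-reverse : ∀ xs → sum (reverse xs) ≡ sum xs
sum-reverse xs = sum-↭ (↭-reverse xs)

sum-double : ∀ xs → sum (map (2 *_) xs) ≡ 2 * sum xs
sum-double []       = refl
sum-double (x ∷ xs) rewrite sum-double xs = sym (*-distribˡ-+ 2 x (sum xs))

sum-replicate-1 : ∀ k → sum (replicate k 1) ≡ k
sum-replicate-1 zero    = refl
sum-replicate-1 (suc k) = cong suc (sum-replicate-1 k)

noOnes⇒doubled : ∀ xs → all isPow2 xs ≡ true → noOnes xs ≡ true → ∃ λ hs → xs ≡ map (2 *_) hs
noOnes⇒doubled []       p no1 = [] , refl
noOnes⇒doubled (x ∷ xs) p no1 with isPow2⇒even {x} (∧-conicalˡ _ _ p) (not≡true⇒≡false (∧-conicalˡ _ _ no1))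
... | h , refl with noOnes⇒doubled xs (∧-conicalʳ (isPow2 (2 * h)) _ p) (∧-conicalʳ (not (1 ≡ᵇ 2 * h)) _ no1)
...   | hs , refl = h ∷ hs , refl

noOnes⇒even-sum : ∀ xs → all isPow2 xs ≡ true → noOnes xs ≡ true → isOdd (sum xs) ≡ false
noOnes⇒even-sum xs p no1 with noOnes⇒doubled xs p no1
... | hs , refl = trans (cong isOdd (sum-double hs)) (isOdd-double (sum hs))

startsWith-1⇒odd-sum : ∀ y → isOC y ≡ true → startsWith 1 y ≡ true → isOdd (sum y) ≡ true
startsWith-1⇒odd-sum (x ∷ xs) e starts rewrite ≡ᵇ-true⇒≡ {x} starts with leading-block 1 xs
... | k , w , split , _ , runs-split = begin
  isOdd (sum (1 ∷ xs))                      ≡⟨ cong (λ z → isOdd (sum z)) split ⟩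
  isOdd (sum (replicate (suc k) 1 ++ w))    ≡⟨ cong isOdd (sum-++ (replicate (suc k) 1) w) ⟩
  isOdd (sum (replicate (suc k) 1) + sum w) ≡⟨ cong (λ z → isOdd (z + sum w)) (sum-replicate-1 (suc k)) ⟩
  isOdd (suc k + sum w)                     ≡⟨ isOdd-+ (suc k) (sum w) ⟩
  isOdd (suc k) xor isOdd (sum w)           ≡⟨ cong (isOdd (suc k) xor_) (noOnes⇒even-sum w pow2-w noOnes-w) ⟩
  isOdd (suc k) xor false                   ≡⟨ xor-identityʳ (isOdd (suc k)) ⟩
  isOdd (suc k)                             ≡⟨ ∧-conicalˡ _ _ oddRuns ⟩
  true                                      ∎
  where
  open ≡-Reasoning
  pow2-w : all isPow2 w ≡ true
  pow2-w = ∧-conicalʳ (all isPow2 (replicate (suc k) 1)) _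
    (trans (sym (all-++ isPow2 (replicate (suc k) 1) w)) (subst-true (all isPow2) split (isOC⇒all-isPow2 (1 ∷ xs) e)))
  oddRuns : all oddRun ((1 , suc k) ∷ runs w) ≡ true
  oddRuns = subst-true (all oddRun) runs-split (isOC⇒oddRuns (1 ∷ xs) e)
  noOnes-w : noOnes w ≡ true
  noOnes-w = trans (sym (all-values-runs _ w))
    (∧-conicalˡ _ _ (subst-true (λ R → distinct (map proj₁ R)) runs-split (isOC⇒distinct (1 ∷ xs) e)))

min-∈-nondecr⇒startsWith : ∀ {x} as bs → nondecr as ≡ true → x ∈ as →
  (∀ {z} → z ∈ as ++ bs → x ≤ z) → startsWith x (as ++ bs) ≡ true
min-∈-nondecr⇒startsWith (a ∷ as) bs up x∈as x≤ with ≤-antisym (nondecr-head-≤ a as up x∈as) (x≤ (here refl))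
... | refl = ≡ᵇ-refl a

one-at-an-end : ∀ y → isOC y ≡ true → noOnes y ≡ false →
  startsWith 1 y ≡ true ⊎ startsWith 1 (reverse y) ≡ true
one-at-an-end y e has1 with all≡false⇒∃ (λ z → not (1 ≡ᵇ z)) y has1
... | z , z∈y , z-is-1 with ≡ᵇ-true⇒≡ {1} {z} (not≡false⇒≡true z-is-1)
... | refl with weaklyUnimodal⇒split y (isOC⇒weaklyUnimodal y e)
... | as , bs , refl , up , down with ∈-++⁻ as z∈y
...   | inj₁ 1∈as = inj₁ (min-∈-nondecr⇒startsWith as bs up 1∈as (isOC⇒1≤ (as ++ bs) e))
...   | inj₂ 1∈bs rewrite reverse-++ as bs =
  inj₂ (min-∈-nondecr⇒startsWith (reverse bs) (reverse as) (trans (nondecr-reverse bs) down) (reverse⁺ 1∈bs)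
         (isOC⇒1≤ (reverse bs ++ reverse as) (subst-true isOC (reverse-++ as bs) (isOC-reverse⁺ (as ++ bs) e))))

even-sum⇒noOnes : ∀ y → isOC y ≡ true → isOdd (sum y) ≡ false → noOnes y ≡ true
even-sum⇒noOnes y e even with noOnes y in no1
... | true  = refl
... | false with one-at-an-end y e no1
...   | inj₁ starts = ⊥-elim (true≢false (trans (sym (startsWith-1⇒odd-sum y e starts)) even))
...   | inj₂ ends   = ⊥-elim (true≢false (trans (sym (startsWith-1⇒odd-sum (reverse y) (isOC-reverse⁺ y e) ends))
                                                 (trans (cong isOdd (sum-reverse y)) even)))

odd-sum⇒one-at-an-end : ∀ y → isOC y ≡ true → isOdd (sum y) ≡ true →
  startsWith 1 y ≡ true ⊎ startsWith 1 (reverse y) ≡ true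
odd-sum⇒one-at-an-end y e odd with noOnes y in no1
... | false = one-at-an-end y e no1
... | true  = ⊥-elim (true≢false (trans (sym odd) (noOnes⇒even-sum y (isOC⇒all-isPow2 y e) no1)))

∈-range1⁻ : ∀ {m k} → k ∈ range1 m → k ≤ m
∈-range1⁻ k∈ with ∈-map⁻ suc k∈
... | i , i∈ , refl = ∈-upTo⁻ i∈

∈-range1⁺ : ∀ {m k} → suc k ≤ m → suc k ∈ range1 m
∈-range1⁺ lt = ∈-map⁺ suc (∈-upTo⁺ lt)

compsF-sound : ∀ fuel m {xs} → xs ∈ compsF fuel m → sum xs ≡ m
compsF-sound fuel       zero    (here refl) = refl
compsF-sound (suc fuel) (suc m) xs∈
  with find (∈-concatMap⁻ (λ k → map (k ∷_) (compsF fuel (suc m ∸ k))) {xs = range1 (suc m)} xs∈)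
... | k , k∈ , xs∈k with ∈-map⁻ (k ∷_) xs∈k
...   | ys , ys∈ , refl = trans (cong (k +_) (compsF-sound fuel (suc m ∸ k) ys∈)) (m+[n∸m]≡n (∈-range1⁻ k∈))

compsF-complete : ∀ fuel xs → (∀ {x} → x ∈ xs → 1 ≤ x) → length xs ≤ fuel → xs ∈ compsF fuel (sum xs)
compsF-complete fuel       []       pos len     = here refl
compsF-complete (suc fuel) (k ∷ ys) pos (s≤s len) with pos (here refl)
... | s≤s {n = j} z≤n =
  ∈-concatMap⁺ (λ k → map (k ∷_) (compsF fuel (suc (j + sum ys) ∸ k)))
    (lose (∈-range1⁺ (s≤s (m≤m+n j (sum ys))))
    (∈-map⁺ (suc j ∷_) (subst (λ s → ys ∈ compsF fuel s) (sym (m+n∸m≡n j (sum ys)))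
      (compsF-complete fuel ys (λ y∈ys → pos (there y∈ys)) len))))

length≤sum : ∀ xs → (∀ {x} → x ∈ xs → 1 ≤ x) → length xs ≤ sum xs
length≤sum []       pos = z≤n
length≤sum (x ∷ xs) pos = +-mono-≤ (pos (here refl)) (length≤sum xs (λ x∈xs → pos (there x∈xs)))

concatMap-∷-unique : ∀ (F : ℕ → List (List ℕ)) ks → Unique ks → (∀ k → Unique (F k)) →
  Unique (concatMap (λ k → map (k ∷_) (F k)) ks)
concatMap-∷-unique F []       _          _  = []
concatMap-∷-unique F (k ∷ ks) (k∉ks ∷ u) uF =
  ++⁺ (map⁺ (λ { refl → refl }) (uF k)) (concatMap-∷-unique F ks u uF) disjoint
  where
  disjoint : Disjoint (map (k ∷_) (F k)) (concatMap (λ k → map (k ∷_) (F k)) ks)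
  disjoint (xs∈here , xs∈rest)
    with ∈-map⁻ (k ∷_) xs∈here | find (∈-concatMap⁻ (λ k → map (k ∷_) (F k)) {xs = ks} xs∈rest)
  ... | _ , _ , refl | j , j∈ks , xs∈j with ∈-map⁻ (j ∷_) xs∈j
  ...   | _ , _ , refl = lookup k∉ks j∈ks refl

compsF-unique : ∀ fuel m → Unique (compsF fuel m)
compsF-unique fuel       zero    = [] ∷ []
compsF-unique zero       (suc m) = []
compsF-unique (suc fuel) (suc m) =
  concatMap-∷-unique (λ k → compsF fuel (suc m ∸ k)) (range1 (suc m))
    (map⁺ suc-injective (upTo⁺ (suc m))) (λ k → compsF-unique fuel (suc m ∸ k))

OCs : ℕ → List (List ℕ)
OCs n = filter (λ xs → isOC xs ≟ true) (compositions n)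

∈-OCs⁻ : ∀ n {xs} → xs ∈ OCs n → sum xs ≡ n × isOC xs ≡ true
∈-OCs⁻ n xs∈ with ∈-filter⁻ (λ xs → isOC xs ≟ true) {xs = compositions n} xs∈
... | xs∈comps , oc-xs = compsF-sound n n xs∈comps , oc-xs

∈-OCs⁺ : ∀ {n xs} → sum xs ≡ n → isOC xs ≡ true → xs ∈ OCs n
∈-OCs⁺ {xs = xs} refl oc-xs = ∈-filter⁺ (λ xs → isOC xs ≟ true)
  (compsF-complete (sum xs) xs (isOC⇒1≤ xs oc-xs) (length≤sum xs (isOC⇒1≤ xs oc-xs))) oc-xs

OCs-unique : ∀ n → Unique (OCs n)
OCs-unique n = filter⁺ (λ xs → isOC xs ≟ true) (compsF-unique n n)

length-≡-by-inverses : ∀ {X Y : Set} {A : List X} {B : List Y} → Unique A → Unique B →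
  (f : X → Y) (g : Y → X) →
  (∀ {a} → a ∈ A → f a ∈ B) → (∀ {b} → b ∈ B → g b ∈ A) →
  (∀ {a} → a ∈ A → g (f a) ≡ a) → (∀ {b} → b ∈ B → f (g b) ≡ b) →
  length A ≡ length B
length-≡-by-inverses {A = A} {B} uA uB f g fA gB gf fg =
  trans (sym (length-map f A)) (↭-length (∼bag⇒↭ (unique∧set⇒bag (map-unique uA gf) uB (mk⇔ to from))))
  where
  map-fresh : ∀ {a} A′ → All (a ≢_) A′ → g (f a) ≡ a → (∀ {x} → x ∈ A′ → g (f x) ≡ x) →
              All (f a ≢_) (map f A′)
  map-fresh []       _          _   _   = []
  map-fresh (x ∷ A′) (a≢x ∷ a∉) gfa gfA′ =
    (λ fa≡fx → a≢x (trans (sym gfa) (trans (cong g fa≡fx) (gfA′ (here refl)))))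
    ∷ map-fresh A′ a∉ gfa (λ x∈ → gfA′ (there x∈))
  map-unique : ∀ {A′} → Unique A′ → (∀ {x} → x ∈ A′ → g (f x) ≡ x) → Unique (map f A′)
  map-unique             []          _   = []
  map-unique {a ∷ A′} (a∉ ∷ u) gfA =
    map-fresh A′ a∉ (gfA (here refl)) (λ x∈ → gfA (there x∈)) ∷ map-unique u (λ x∈ → gfA (there x∈))
  to : ∀ {y} → y ∈ map f A → y ∈ B
  to y∈ with ∈-map⁻ f y∈
  ... | a , a∈A , refl = fA a∈A
  from : ∀ {y} → y ∈ B → y ∈ map f A
  from y∈B = subst (_∈ map f A) (fg y∈B) (∈-map⁺ f (gB y∈B))

halve-double : ∀ hs → map ⌊_/2⌋ (map (2 *_) hs) ≡ hs
halve-double []       = refl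
halve-double (h ∷ hs) =
  cong₂ _∷_ (sym (trans (n≡⌊n+n/2⌋ h) (cong (λ z → ⌊ h + z /2⌋) (sym (+-identityʳ h))))) (halve-double hs)

∈-OCs-even⇒doubled : ∀ h {b} → b ∈ OCs (2 * h) → ∃ λ hs → b ≡ map (2 *_) hs
∈-OCs-even⇒doubled h {b} b∈ with ∈-OCs⁻ (2 * h) b∈
... | sum-b , oc-b = noOnes⇒doubled b (isOC⇒all-isPow2 b oc-b)
                       (even-sum⇒noOnes b oc-b (trans (cong isOdd sum-b) (isOdd-double h)))

oc-double : ∀ h → oc (2 * h) ≡ oc h
oc-double h = sym (length-≡-by-inverses (OCs-unique h) (OCs-unique (2 * h))
                    (map (2 *_)) (map ⌊_/2⌋) double-∈ halve-∈ (λ {hs} _ → halve-double hs) double-halve)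
  where
  double-∈ : ∀ {hs} → hs ∈ OCs h → map (2 *_) hs ∈ OCs (2 * h)
  double-∈ {hs} hs∈ with ∈-OCs⁻ h hs∈
  ... | sum-hs , oc-hs = ∈-OCs⁺ (trans (sum-double hs) (cong (2 *_) sum-hs)) (trans (isOC-double hs) oc-hs)
  halve-∈ : ∀ {b} → b ∈ OCs (2 * h) → map ⌊_/2⌋ b ∈ OCs h
  halve-∈ b∈ with ∈-OCs⁻ (2 * h) b∈ | ∈-OCs-even⇒doubled h b∈
  ... | sum-b , oc-b | hs , refl rewrite halve-double hs =
    ∈-OCs⁺ (*-cancelˡ-≡ (sum hs) h 2 (trans (sym (sum-double hs)) sum-b)) (trans (sym (isOC-double hs)) oc-b)
  double-halve : ∀ {b} → b ∈ OCs (2 * h) → map (2 *_) (map ⌊_/2⌋ b) ≡ b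
  double-halve b∈ with ∈-OCs-even⇒doubled h b∈
  ... | hs , refl = cong (map (2 *_)) (halve-double hs)

data Shrunk : Set where
  front back inner : List ℕ → Shrunk

addOnes : Bool → List ℕ → List ℕ
addOnes true  ys = 1 ∷ 1 ∷ ys
addOnes false ys = ys ++ 1 ∷ 1 ∷ []

grow : Shrunk → List ℕ
grow (front ys) = 1 ∷ ys
grow (back ys)  = ys ++ 1 ∷ []
grow (inner ys) = addOnes (startsWith 1 ys) ys

shrinkFront : Bool → List ℕ → Shrunk
shrinkFront true  y = inner (drop 2 y)
shrinkFront false y = front (drop 1 y)

shrinkBack : Bool → List ℕ → Shrunk
shrinkBack true  r = inner (reverse (drop 2 r))
shrinkBack false r = back (reverse (drop 1 r))

shrinkAt : Bool → List ℕ → Shrunk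
shrinkAt true  y = shrinkFront (startsWith 1 (drop 1 y)) y
shrinkAt false y = shrinkBack (startsWith 1 (drop 1 (reverse y))) (reverse y)

shrink : List ℕ → Shrunk
shrink y = shrinkAt (startsWith 1 y) y

startsWith-++ : ∀ x ys zs → ys ≢ [] → startsWith x (ys ++ zs) ≡ startsWith x ys
startsWith-++ x []      zs ys≢[] = ⊥-elim (ys≢[] refl)
startsWith-++ x (_ ∷ _) zs _     = refl

sum≢0⇒≢[] : ∀ {ys n} → sum ys ≡ n → n ≢ 0 → ys ≢ []
sum≢0⇒≢[] refl n≢0 refl = n≢0 refl

reverse-++-reverse : ∀ (xs ys : List ℕ) → reverse (xs ++ reverse ys) ≡ ys ++ reverse xs
reverse-++-reverse xs ys = trans (reverse-++ xs (reverse ys)) (cong (_++ reverse xs) (reverse-involutive ys))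

isOC-append-1 : ∀ ys → isOC ys ≡ true → noOnes ys ≡ true → isOC (ys ++ 1 ∷ []) ≡ true
isOC-append-1 ys e no1 = subst-true isOC (reverse-++-reverse (1 ∷ []) ys)
  (isOC-reverse⁺ (1 ∷ reverse ys)
    (isOC-prepend-1 (reverse ys) (trans (isOC-reverse ys) e) (trans (all-reverse _ ys) no1)))

∈-OCs-reverse : ∀ n {ys} → ys ∈ OCs n → reverse ys ∈ OCs n
∈-OCs-reverse n {ys} ys∈ with ∈-OCs⁻ n ys∈
... | sum-ys , oc-ys = ∈-OCs⁺ (trans (sum-reverse ys) sum-ys) (trans (isOC-reverse ys) oc-ys)

module OddCase (m : ℕ) (m-odd : isOdd m ≡ true) where

  m≢0 : m ≢ 0
  m≢0 refl = true≢false (sym m-odd)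

  candidates : List Shrunk
  candidates = map front (OCs (suc m)) ++ map back (OCs (suc m)) ++ map inner (OCs m)

  length-candidates : length candidates ≡ 2 * oc (suc m) + oc m
  length-candidates
    rewrite length-++ (map front (OCs (suc m))) {map back (OCs (suc m)) ++ map inner (OCs m)}
          | length-++ (map back (OCs (suc m))) {map inner (OCs m)}
          | length-map front (OCs (suc m)) | length-map back (OCs (suc m)) | length-map inner (OCs m)
          | +-identityʳ (oc (suc m)) = sym (+-assoc (oc (suc m)) (oc (suc m)) (oc m))

  candidates-unique : Unique candidates
  candidates-unique =
    ++⁺ (map⁺ (λ { refl → refl }) (OCs-unique (suc m)))
        (++⁺ (map⁺ (λ { refl → refl }) (OCs-unique (suc m))) (map⁺ (λ { refl → refl }) (OCs-unique m))
             back∉inner)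
        front∉rest
    where
    back∉inner : Disjoint (map back (OCs (suc m))) (map inner (OCs m))
    back∉inner (p , q) with ∈-map⁻ back p | ∈-map⁻ inner q
    ... | _ , _ , refl | _ , _ , ()
    front∉rest : Disjoint (map front (OCs (suc m))) (map back (OCs (suc m)) ++ map inner (OCs m))
    front∉rest (p , q) with ∈-map⁻ front p | ∈-++⁻ (map back (OCs (suc m))) q
    ... | _ , _ , refl | inj₁ q′ with ∈-map⁻ back q′
    ...   | _ , _ , ()
    front∉rest (p , q) | _ , _ , refl | inj₂ q′ with ∈-map⁻ inner q′
    ...   | _ , _ , ()

  ∈-OCs-even⇒noOnes : ∀ {ys} → ys ∈ OCs (suc m) → noOnes ys ≡ true
  ∈-OCs-even⇒noOnes {ys} ys∈ with ∈-OCs⁻ (suc m) ys∈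
  ... | sum-ys , oc-ys = even-sum⇒noOnes ys oc-ys (trans (cong isOdd sum-ys) (cong not m-odd))

  leading-ones : ∀ t → (1 ∷ t) ∈ OCs (suc (suc m)) →
    (startsWith 1 t ≡ false × t ∈ OCs (suc m)) ⊎ (∃ λ u → t ≡ 1 ∷ u × startsWith 1 u ≡ true × u ∈ OCs m)
  leading-ones t 1∷t∈ with ∈-OCs⁻ (suc (suc m)) 1∷t∈ | startsWith 1 t in starts
  ... | sum-1∷t , oc-1∷t | false = inj₁ (refl , ∈-OCs⁺ (suc-injective sum-1∷t) (isOC-drop-1 t oc-1∷t starts))
  ... | sum-1∷t , oc-1∷t | true with startsWith⇒∷ t starts
  ...   | u , refl with isOC-drop-11 u oc-1∷t
  ...     | v , refl , oc-u = inj₂ (1 ∷ v , refl , refl , ∈-OCs⁺ (suc-injective (suc-injective sum-1∷t)) oc-u)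

  grow-∈ : ∀ {a} → a ∈ candidates → grow a ∈ OCs (suc (suc m))
  grow-∈ a∈ with ∈-++⁻ (map front (OCs (suc m))) a∈
  ... | inj₁ p with ∈-map⁻ front p
  ...   | ys , ys∈ , refl with ∈-OCs⁻ (suc m) ys∈
  ...     | sum-ys , oc-ys = ∈-OCs⁺ (cong suc sum-ys) (isOC-prepend-1 ys oc-ys (∈-OCs-even⇒noOnes ys∈))
  grow-∈ a∈ | inj₂ p with ∈-++⁻ (map back (OCs (suc m))) p
  ... | inj₁ q with ∈-map⁻ back q
  ...   | ys , ys∈ , refl with ∈-OCs⁻ (suc m) ys∈
  ...     | sum-ys , oc-ys =
    ∈-OCs⁺ (trans (sum-++ ys (1 ∷ [])) (trans (+-comm (sum ys) 1) (cong suc sum-ys)))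
           (isOC-append-1 ys oc-ys (∈-OCs-even⇒noOnes ys∈))
  grow-∈ a∈ | inj₂ p | inj₂ q with ∈-map⁻ inner q
  ... | ys , ys∈ , refl = grow-inner ys ys∈
    where
    grow-inner : ∀ ys → ys ∈ OCs m → addOnes (startsWith 1 ys) ys ∈ OCs (suc (suc m))
    grow-inner ys ys∈ with startsWith 1 ys in starts
    ... | true with startsWith⇒∷ ys starts
    ...   | t , refl with ∈-OCs⁻ m ys∈
    ...     | sum-ys , oc-ys = ∈-OCs⁺ (cong (λ s → suc (suc s)) sum-ys) (trans (isOC-1∷1∷ t) oc-ys)
    grow-inner ys ys∈ | false with ∈-OCs⁻ m ys∈
    ... | sum-ys , oc-ys with odd-sum⇒one-at-an-end ys oc-ys (trans (cong isOdd sum-ys) m-odd)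
    ...   | inj₁ starts′ = ⊥-elim (true≢false (trans (sym starts′) starts))
    ...   | inj₂ ends with startsWith⇒∷ (reverse ys) ends
    ...     | t , rev-ys = subst (_∈ OCs (suc (suc m))) (reverse-++-reverse (1 ∷ 1 ∷ []) ys)
                               (∈-OCs-reverse (suc (suc m)) (∈-OCs⁺ {xs = 1 ∷ 1 ∷ reverse ys} sum-rev oc-11rev))
      where
      oc-rev : isOC (1 ∷ t) ≡ true
      oc-rev = subst-true isOC rev-ys (trans (isOC-reverse ys) oc-ys)
      oc-11rev : isOC (1 ∷ 1 ∷ reverse ys) ≡ true
      oc-11rev = subst-true isOC (cong (λ z → 1 ∷ 1 ∷ z) (sym rev-ys)) (trans (isOC-1∷1∷ t) oc-rev)
      sum-rev : sum (1 ∷ 1 ∷ reverse ys) ≡ suc (suc m)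
      sum-rev = cong (λ s → suc (suc s)) (trans (sum-reverse ys) sum-ys)

  shrink-grow : ∀ {a} → a ∈ candidates → shrink (grow a) ≡ a
  shrink-grow a∈ with ∈-++⁻ (map front (OCs (suc m))) a∈
  ... | inj₁ p with ∈-map⁻ front p
  ...   | ys , ys∈ , refl =
    cong (λ s → shrinkFront s (1 ∷ ys)) (noOnes⇒¬startsWith-1 ys (∈-OCs-even⇒noOnes ys∈))
  shrink-grow a∈ | inj₂ p with ∈-++⁻ (map back (OCs (suc m))) p
  ... | inj₁ q with ∈-map⁻ back q
  ...   | ys , ys∈ , refl = begin
    shrinkAt (startsWith 1 (ys ++ 1 ∷ [])) (ys ++ 1 ∷ [])
      ≡⟨ cong (λ s → shrinkAt s (ys ++ 1 ∷ []))
              (trans (startsWith-++ 1 ys (1 ∷ []) ys≢[]) (noOnes⇒¬startsWith-1 ys no1)) ⟩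
    shrinkBack (startsWith 1 (drop 1 r)) r
      ≡⟨ cong (λ r → shrinkBack (startsWith 1 (drop 1 r)) r) (reverse-++ ys (1 ∷ [])) ⟩
    shrinkBack (startsWith 1 (reverse ys)) (1 ∷ reverse ys)
      ≡⟨ cong (λ s → shrinkBack s (1 ∷ reverse ys))
              (noOnes⇒¬startsWith-1 (reverse ys) (trans (all-reverse _ ys) no1)) ⟩
    back (reverse (reverse ys))
      ≡⟨ cong back (reverse-involutive ys) ⟩
    back ys ∎
    where
    open ≡-Reasoning
    r = reverse (ys ++ 1 ∷ [])
    no1 = ∈-OCs-even⇒noOnes ys∈
    ys≢[] = sum≢0⇒≢[] (proj₁ (∈-OCs⁻ (suc m) ys∈)) λ ()
  shrink-grow a∈ | inj₂ p | inj₂ q with ∈-map⁻ inner q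
  ... | ys , ys∈ , refl with startsWith 1 ys in starts
  ...   | true with startsWith⇒∷ ys starts
  ...     | t , refl = refl
  shrink-grow a∈ | inj₂ p | inj₂ q | ys , ys∈ , refl | false = begin
    shrinkAt (startsWith 1 (ys ++ 1 ∷ 1 ∷ [])) (ys ++ 1 ∷ 1 ∷ [])
      ≡⟨ cong (λ s → shrinkAt s (ys ++ 1 ∷ 1 ∷ [])) (trans (startsWith-++ 1 ys (1 ∷ 1 ∷ []) ys≢[]) starts) ⟩
    shrinkBack (startsWith 1 (drop 1 r)) r
      ≡⟨ cong (λ r → shrinkBack (startsWith 1 (drop 1 r)) r) (reverse-++ ys (1 ∷ 1 ∷ [])) ⟩
    inner (reverse (reverse ys))
      ≡⟨ cong inner (reverse-involutive ys) ⟩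
    inner ys ∎
    where
    open ≡-Reasoning
    r = reverse (ys ++ 1 ∷ 1 ∷ [])
    ys≢[] = sum≢0⇒≢[] (proj₁ (∈-OCs⁻ m ys∈)) m≢0

  Preimage : List ℕ → Shrunk → Set
  Preimage b a = a ∈ candidates × grow a ≡ b

  shrink-front : ∀ t → (1 ∷ t) ∈ OCs (suc (suc m)) → Preimage (1 ∷ t) (shrinkFront (startsWith 1 t) (1 ∷ t))
  shrink-front t 1∷t∈ with leading-ones t 1∷t∈
  ... | inj₁ (starts , t∈) rewrite starts = ∈-++⁺ˡ (∈-map⁺ front t∈) , refl
  ... | inj₂ (u , refl , starts , u∈) rewrite starts =
    ∈-++⁺ʳ (map front (OCs (suc m))) (∈-++⁺ʳ (map back (OCs (suc m))) (∈-map⁺ inner u∈)) , refl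

  shrink-back : ∀ b t → b ∈ OCs (suc (suc m)) → reverse b ≡ 1 ∷ t → startsWith 1 b ≡ false →
    Preimage b (shrinkBack (startsWith 1 t) (1 ∷ t))
  shrink-back b t b∈ rev-b b-fresh
    with leading-ones t (subst (_∈ OCs (suc (suc m))) rev-b (∈-OCs-reverse (suc (suc m)) b∈))
  ... | inj₁ (starts , t∈) rewrite starts =
    ∈-++⁺ʳ (map front (OCs (suc m))) (∈-++⁺ˡ (∈-map⁺ back (∈-OCs-reverse (suc m) t∈))) ,
    sym (trans b≡ (unfold-reverse 1 t))
    where
    b≡ : b ≡ reverse (1 ∷ t)
    b≡ = trans (sym (reverse-involutive b)) (cong reverse rev-b)
  ... | inj₂ (u , refl , starts , u∈) =
    ∈-++⁺ʳ (map front (OCs (suc m))) (∈-++⁺ʳ (map back (OCs (suc m))) (∈-map⁺ inner (∈-OCs-reverse m u∈))) ,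
    trans (cong (λ s → addOnes s (reverse u)) reverse-u-fresh) (sym b≡)
    where
    b≡ : b ≡ reverse u ++ 1 ∷ 1 ∷ []
    b≡ = trans (sym (reverse-involutive b)) (trans (cong reverse rev-b) (reverse-++ (1 ∷ 1 ∷ []) u))
    reverse-u-fresh : startsWith 1 (reverse u) ≡ false
    reverse-u-fresh = trans (sym (startsWith-++ 1 (reverse u) (1 ∷ 1 ∷ [])
                                   (sum≢0⇒≢[] (trans (sum-reverse u) (proj₁ (∈-OCs⁻ m u∈))) m≢0)))
                            (trans (cong (startsWith 1) (sym b≡)) b-fresh)

  shrink-preimage : ∀ {b} → b ∈ OCs (suc (suc m)) → Preimage b (shrink b)
  shrink-preimage {b} b∈ with ∈-OCs⁻ (suc (suc m)) b∈ | startsWith 1 b in starts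
  ... | _ , _ | true with startsWith⇒∷ b starts
  ...   | t , refl = shrink-front t b∈
  shrink-preimage {b} b∈ | sum-b , oc-b | false
    with odd-sum⇒one-at-an-end b oc-b (trans (cong isOdd sum-b) (trans (not-involutive (isOdd m)) m-odd))
  ... | inj₁ starts′ = ⊥-elim (true≢false (trans (sym starts′) starts))
  ... | inj₂ ends with startsWith⇒∷ (reverse b) ends
  ...   | t , rev-b rewrite rev-b = shrink-back b t b∈ rev-b starts

  oc-odd : oc (suc (suc m)) ≡ 2 * oc (suc m) + oc m
  oc-odd = trans (sym (length-≡-by-inverses candidates-unique (OCs-unique (suc (suc m))) grow shrink
                         grow-∈ (λ b∈ → proj₁ (shrink-preimage b∈))
                         shrink-grow (λ b∈ → proj₂ (shrink-preimage b∈))))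
                 length-candidates

%2≡0⇒≡2*[/2] : ∀ n → n % 2 ≡ 0 → n ≡ 2 * (n / 2)
%2≡0⇒≡2*[/2] n n%2≡0 = begin
  n                 ≡⟨ m≡m%n+[m/n]*n n 2 ⟩
  n % 2 + n / 2 * 2 ≡⟨ cong (_+ n / 2 * 2) n%2≡0 ⟩
  n / 2 * 2         ≡⟨ *-comm (n / 2) 2 ⟩
  2 * (n / 2)       ∎
  where open ≡-Reasoning

%2≡1⇒isOdd : ∀ n → n % 2 ≡ 1 → isOdd n ≡ true
%2≡1⇒isOdd n n%2≡1 = begin
  isOdd n                   ≡⟨ cong isOdd (m≡m%n+[m/n]*n n 2) ⟩
  isOdd (n % 2 + n / 2 * 2) ≡⟨ cong (λ r → isOdd (r + n / 2 * 2)) n%2≡1 ⟩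
  not (isOdd (n / 2 * 2))   ≡⟨ cong (λ k → not (isOdd k)) (*-comm (n / 2) 2) ⟩
  not (isOdd (2 * (n / 2))) ≡⟨ cong not (isOdd-double (n / 2)) ⟩
  true                      ∎
  where open ≡-Reasoning

lemma1p1 : (n : ℕ) → 2 ≤ n →
    (n % 2 ≡ 0 → oc n ≡ oc (n / 2)) × (n % 2 ≡ 1 → oc n ≡ 2 * oc (n ∸ 1) + oc (n ∸ 2))
lemma1p1 n@(suc (suc m)) (s≤s (s≤s _)) = even , odd
  where
  even : n % 2 ≡ 0 → oc n ≡ oc (n / 2)
  even n%2≡0 = trans (cong oc (%2≡0⇒≡2*[/2] n n%2≡0)) (oc-double (n / 2))
  odd : n % 2 ≡ 1 → oc n ≡ 2 * oc (suc m) + oc m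
  odd n%2≡1 = OddCase.oc-odd m (trans (sym (not-involutive (isOdd m))) (%2≡1⇒isOdd n n%2≡1))
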